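{- Let $D=(V,A)$ be a finite directed graph, $\{S,T\}$ a partition of $V$ into nonempty sets with no arc from $T$ to $S$, and $w\in\mathbb{Z}_+^A$. Let $\xi\in\{0,1\}^{A[S,T]}$ be an optimal flow for (MSF) and let $(p,q)\in\mathbb{Z}^S\times\mathbb{Z}^T$ satisfy conditions (i)–(iii) below together with $\xi$, and moreover $w(a)+p(u)-q(v)=0$ for every $a=uv\in A[S,T]$ with $\xi(a)=1$. Let $D_T=(V_T,A_T)$ with $V_T=\{r_T\}\cup T$ ($r_T$ a new vertex), $A_T=\{r_Tv: v\in T\}\cup A[T]$, and arc weights $w'(r_Tv)=q(v)$ for $v\in T$, $w'(uv)=w(uv)$ for $uv\in A[T]$. Then $D_T$ has a minimum-$w'$-weight $r_T$-arborescence $\tilde B_T$ such that $R(\tilde B_T\cap A[T])=\mathrm{supp}^+(-\partial\xi|_T)$.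
   Context: An arc $uv$ leaves $u$ and enters $v$; $\delta^+u$ ($\delta^-u$) is the set of arcs leaving (entering) $u$. $A[X]$ denotes arcs with both ends in $X$, $A[S,T]=\{uv\in A:u\in S,v\in T\}$; $D[S]=(S,A[S])$, $D[T]=(T,A[T])$. A branching is an arc set with no directed cycle in which every vertex is entered by at most one arc; an $r$-arborescence is a branching in which every vertex other than $r$ is entered by an arc. For a branching $B$ in $D[T]$, $R(B)$ is the set of vertices of $T$ entered by no arc of $B$. A cobranching is an arc set whose reversal is a branching; for a cobranching $B$ in $D[S]$, $R^*(B)$ is the set of vertices of $S$ left by no arc of $B$. $\mathrm{supp}^+(\eta)=\{u:\eta(u)>0\}$. $g_T(\eta)=\min\{w(B): B\text{ branching in }D[T], R(B)=\mathrm{supp}^+(\eta)\}$ for $\eta\in\mathbb{Z}_+^T$ when such a branching exists, else $+\infty$; $g_S$ analogous with cobranchings in $D[S]$ and $R^*$. For $\xi\in\{0,1\}^{A[S,T]}$, $\partial\xi(v)=|\{a\in\delta^+v:\xi(a)=1\}|-|\{a\in\delta^-v:\xi(a)=1\}|$. $\xi$ is feasible if $g_S(\partial\xi|_S)<\infty$ and $g_T(-\partial\xi|_T)<\infty$; an optimal flow is a feasible minimizer of $\sum_{a\in A[S,T]}w(a)\xi(a)+g_S(\partial\xi|_S)+g_T(-\partial\xi|_T)$ over $\{0,1\}^{A[S,T]}$ (problem (MSF)). $g_S[-p](\eta)=g_S(\eta)-\sum_u p(u)\eta(u)$, $g_T[+q](\zeta)=g_T(\zeta)+\sum_v q(v)\zeta(v)$.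 Conditions: (i) for every $a=uv\in A[S,T]$, $\xi(a)=1\Rightarrow w(a)+p(u)-q(v)\le0$ and $\xi(a)=0\Rightarrow w(a)+p(u)-q(v)\ge0$; (ii) $\partial\xi|_S\in\arg\min g_S[-p]$; (iii) $-\partial\xi|_T\in\arg\min g_T[+q]$. -}

module Defs where

open import Data.Nat as ℕ using (ℕ; zero; suc)
open import Data.Integer using (ℤ; +_; _+_; _-_; -_; _*_; _≤_; _<_; 0ℤ; 1ℤ)
open import Data.Fin using (Fin; zero; suc; _≟_)
open import Data.Bool using (Bool; true; false; if_then_else_; _∧_)
open import Data.Maybe using (Maybe; just; nothing)
open import Data.Sum using (_⊎_; inj₁; inj₂)
open import Data.Product using (Σ; ∃; _×_; _,_)
open import Relation.Binary.PropositionalEquality using (_≡_)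
open import Relation.Nullary using (¬_)
open import Relation.Nullary.Decidable using (⌊_⌋)

Iff : Set → Set → Set
Iff P Q = (P → Q) × (Q → P)

data Walk {Arc V : Set} (tl hd : Arc → V) (B : Arc → Bool) : V → V → Set where
  []   : ∀ {x} → Walk tl hd B x x
  step : ∀ {x y} (a : Arc) → B a ≡ true → tl a ≡ x →
         Walk tl hd B (hd a) y → Walk tl hd B x y

HasCycle : {Arc V : Set} (tl hd : Arc → V) (B : Arc → Bool) → Set
HasCycle {Arc} tl hd B = Σ Arc λ a → B a ≡ true × Walk tl hd B (hd a) (tl a)

IsBranching : {Arc V : Set} (tl hd : Arc → V) (B : Arc → Bool) → Set
IsBranching {Arc} tl hd B =
  ¬ HasCycle tl hd B ×
  ((a a' : Arc) → B a ≡ true → B a' ≡ true → hd a ≡ hd a' → a ≡ a')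

IsCobranching : {Arc V : Set} (tl hd : Arc → V) (B : Arc → Bool) → Set
IsCobranching tl hd B = IsBranching hd tl B

Entered : {Arc V : Set} (tl hd : Arc → V) (B : Arc → Bool) → V → Set
Entered {Arc} tl hd B v = Σ Arc λ a → B a ≡ true × hd a ≡ v

sumFin : ∀ {k} → (Fin k → ℤ) → ℤ
sumFin {zero}  f = 0ℤ
sumFin {suc k} f = f zero + sumFin (λ i → f (suc i))

weight : ∀ {k} → (Fin k → Bool) → (Fin k → ℤ) → ℤ
weight B w = sumFin (λ a → if B a then w a else 0ℤ)

-- The setting: D = (Fin n, Fin m) with tail/head maps tl, hd;
-- side v = true means v ∈ S, side v = false means v ∈ T;
-- w : arc weights in ℤ₊.

module MSF {n m : ℕ} (tl hd : Fin m → Fin n) (side : Fin n → Bool)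
           (w : Fin m → ℕ) where

  InS InT : Fin n → Set
  InS v = side v ≡ true
  InT v = side v ≡ false

  InAS InAT InAST : Fin m → Set
  InAS a  = InS (tl a) × InS (hd a)
  InAT a  = InT (tl a) × InT (hd a)
  InAST a = InS (tl a) × InT (hd a)

  wℤ : Fin m → ℤ
  wℤ a = + w a

  -- ξ ∈ {0,1}^{A[S,T]}, encoded as a Boolean arc function vanishing
  -- outside A[S,T]
  Flow : (Fin m → Bool) → Set
  Flow ξ = (a : Fin m) → ξ a ≡ true → InAST a

  ∂ : (Fin m → Bool) → Fin n → ℤ
  ∂ ξ v = sumFin (λ a → if ξ a ∧ ⌊ tl a ≟ v ⌋ then 1ℤ else 0ℤ)
        - sumFin (λ a → if ξ a ∧ ⌊ hd a ≟ v ⌋ then 1ℤ else 0ℤ)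

  m∂ : (Fin m → Bool) → Fin n → ℤ
  m∂ ξ v = - ∂ ξ v

  -- B is a branching in D[T] with R(B) = supp⁺(η) (as subsets of T)
  BranchT : (Fin n → ℤ) → (Fin m → Bool) → Set
  BranchT η B = ((a : Fin m) → B a ≡ true → InAT a) × IsBranching tl hd B ×
                ((v : Fin n) → InT v → Iff (¬ Entered tl hd B v) (0ℤ < η v))

  -- B is a cobranching in D[S] with R*(B) = supp⁺(η) (as subsets of S)
  CobranchS : (Fin n → ℤ) → (Fin m → Bool) → Set
  CobranchS η B = ((a : Fin m) → B a ≡ true → InAS a) × IsCobranching tl hd B ×
                  ((u : Fin n) → InS u → Iff (¬ Entered hd tl B u) (0ℤ < η u))

  -- g_T(η) = c  (η ∈ ℤ₊^T, finite value c); only values on T matter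
  GT : (Fin n → ℤ) → ℤ → Set
  GT η c = ((v : Fin n) → InT v → 0ℤ ≤ η v) ×
           (Σ (Fin m → Bool) λ B → BranchT η B × weight B wℤ ≡ c) ×
           ((B : Fin m → Bool) → BranchT η B → c ≤ weight B wℤ)

  -- g_S(η) = c  (η ∈ ℤ₊^S, finite value c); only values on S matter
  GS : (Fin n → ℤ) → ℤ → Set
  GS η c = ((u : Fin n) → InS u → 0ℤ ≤ η u) ×
           (Σ (Fin m → Bool) λ B → CobranchS η B × weight B wℤ ≡ c) ×
           ((B : Fin m → Bool) → CobranchS η B → c ≤ weight B wℤ)

  OptimalFlow : (Fin m → Bool) → Set
  OptimalFlow ξ =
    Flow ξ ×
    Σ ℤ λ cS → Σ ℤ λ cT → GS (∂ ξ) cS × GT (m∂ ξ) cT ×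
      ((ξ' : Fin m → Bool) (cS' cT' : ℤ) → Flow ξ' →
        GS (∂ ξ') cS' → GT (m∂ ξ') cT' →
        weight ξ wℤ + cS + cT ≤ weight ξ' wℤ + cS' + cT')

  dotS : (Fin n → ℤ) → (Fin n → ℤ) → ℤ
  dotS p η = sumFin (λ u → if side u then p u * η u else 0ℤ)

  dotT : (Fin n → ℤ) → (Fin n → ℤ) → ℤ
  dotT q ζ = sumFin (λ v → if side v then 0ℤ else q v * ζ v)

  CondI : (Fin m → Bool) → (Fin n → ℤ) → (Fin n → ℤ) → Set
  CondI ξ p q = (a : Fin m) → InAST a →
    (ξ a ≡ true  → wℤ a + p (tl a) - q (hd a) ≤ 0ℤ) ×
    (ξ a ≡ false → 0ℤ ≤ wℤ a + p (tl a) - q (hd a))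

  -- condition (ii): ∂ξ|_S ∈ argmin g_S[−p]
  CondII : (Fin m → Bool) → (Fin n → ℤ) → Set
  CondII ξ p = Σ ℤ λ c → GS (∂ ξ) c ×
    ((η : Fin n → ℤ) (c' : ℤ) → GS η c' → c - dotS p (∂ ξ) ≤ c' - dotS p η)

  -- condition (iii): −∂ξ|_T ∈ argmin g_T[+q]
  CondIII : (Fin m → Bool) → (Fin n → ℤ) → Set
  CondIII ξ q = Σ ℤ λ c → GT (m∂ ξ) c ×
    ((ζ : Fin n → ℤ) (c' : ℤ) → GT ζ c' → c + dotT q (m∂ ξ) ≤ c' + dotT q ζ)

  Tight : (Fin m → Bool) → (Fin n → ℤ) → (Fin n → ℤ) → Set
  Tight ξ p q = (a : Fin m) → InAST a → ξ a ≡ true →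
    wℤ a + p (tl a) - q (hd a) ≡ 0ℤ

  -- The auxiliary digraph D_T.  Vertices: Maybe (Fin n), nothing = r_T
  -- (only nothing and just v with v ∈ T are used).  Arcs: inj₁ v is
  -- r_T v (v ∈ T), inj₂ a is an arc a ∈ A[T].

  ArcT : Set
  ArcT = Fin n ⊎ Fin m

  tlT hdT : ArcT → Maybe (Fin n)
  tlT (inj₁ v) = nothing
  tlT (inj₂ a) = just (tl a)
  hdT (inj₁ v) = just v
  hdT (inj₂ a) = just (hd a)

  ValidT : ArcT → Set
  ValidT (inj₁ v) = InT v
  ValidT (inj₂ a) = InAT a

  weightT : (Fin n → ℤ) → (ArcT → Bool) → ℤ
  weightT q B = sumFin (λ v → if B (inj₁ v) then q v else 0ℤ)
              + sumFin (λ a → if B (inj₂ a) then wℤ a else 0ℤ)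

  -- r_T-arborescence of D_T: a branching in D_T in which every vertex
  -- other than r_T is entered (r_T is never entered in D_T)
  IsRTArb : (ArcT → Bool) → Set
  IsRTArb B = ((x : ArcT) → B x ≡ true → ValidT x) × IsBranching tlT hdT B ×
              ((v : Fin n) → InT v → Entered tlT hdT B (just v))

  MinRTArb : (Fin n → ℤ) → (ArcT → Bool) → Set
  MinRTArb q B = IsRTArb B × ((B' : ArcT → Bool) → IsRTArb B' → weightT q B ≤ weightT q B')

  restrictA : (ArcT → Bool) → Fin m → Bool
  restrictA B a = B (inj₂ a)

module Submission where

-- Only condition (iii) is needed.  Put ζ = −∂ξ and let c = g_T(ζ),
-- attained by a branching B_T of D[T] with R(B_T) = supp⁺ ζ.  Adding the arcs
-- r_T v for v ∈ supp⁺ ζ to B_T gives an r_T-arborescence B̃_T of D_T with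
-- R(B̃_T ∩ A[T]) = supp⁺ ζ and w'(B̃_T) = q(supp⁺ ζ) + c.  It is minimum:
--   (a) ζ₂ = 2ζ − 𝟙_{supp⁺ ζ} has the same support as ζ, so g_T(ζ₂) = c, and
--       (iii) applied to ζ₂ yields q(supp⁺ ζ) ≤ ⟨q, ζ⟩;
--   (b) any r_T-arborescence B' splits as its root arcs, with head indicator ρ,
--       and a branching B' ∩ A[T] of D[T] with R = supp⁺ ρ, so
--       w'(B') = ⟨q, ρ⟩ + w(B' ∩ A[T]) ≥ ⟨q, ρ⟩ + g_T(ρ) ≥ ⟨q, ζ⟩ + c by (iii).
-- Constructively g_T(ρ) is only known to exist up to double negation (a
-- minimum of a nonnegative integer function); since ≤ on ℤ is decidable
-- this suffices.

open import Defs
open import Data.Nat using (ℕ; zero; suc; s≤s; z≤n)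
import Data.Nat.Properties as ℕP
open import Data.Integer using (ℤ; 0ℤ; 1ℤ; +_; _+_; _-_; _*_; _≤_; _<_; _≤?_; _<?_; +≤+; +<+; -≤+; -<+; ∣_∣)
import Data.Integer.Properties as ℤP
open import Data.Integer.Tactic.RingSolver using (solve-∀)
open import Data.Fin using (Fin; zero; suc)
import Data.Fin as Fin
open import Data.Fin.Properties using (any?)
open import Data.Bool using (Bool; true; false; if_then_else_)
import Data.Bool as Bool
open import Data.Maybe using (just; nothing)
open import Data.Maybe.Properties using (just-injective)
open import Data.Sum using (inj₁; inj₂)
open import Data.Sum.Properties using (inj₂-injective)
open import Data.Product using (Σ; _×_; _,_; proj₁; proj₂)
open import Data.Empty using (⊥; ⊥-elim)
open import Relation.Binary.PropositionalEquality using (_≡_; refl; sym; trans; cong; cong₂; subst; module ≡-Reasoning)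
open import Relation.Nullary using (¬_; Dec; yes; no)
open import Relation.Nullary.Decidable using (⌊_⌋; decidable-stable; _×-dec_)

sumFin-cong : ∀ {k} {f g : Fin k → ℤ} → (∀ i → f i ≡ g i) → sumFin f ≡ sumFin g
sumFin-cong {zero}  eq = refl
sumFin-cong {suc k} eq = cong₂ _+_ (eq zero) (sumFin-cong (λ i → eq (suc i)))

sumFin-+ : ∀ {k} (f g : Fin k → ℤ) → sumFin (λ i → f i + g i) ≡ sumFin f + sumFin g
sumFin-+ {zero}  f g = refl
sumFin-+ {suc k} f g =
  trans (cong (_+_ (f zero + g zero)) (sumFin-+ (λ i → f (suc i)) (λ i → g (suc i))))
        (interchange (f zero) (g zero) (sumFin (λ i → f (suc i))) (sumFin (λ i → g (suc i))))
  where
  interchange : ∀ a b x y → a + b + (x + y) ≡ a + x + (b + y)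
  interchange = solve-∀

sumFin-nonneg : ∀ {k} (f : Fin k → ℤ) → (∀ i → 0ℤ ≤ f i) → 0ℤ ≤ sumFin f
sumFin-nonneg {zero}  f nn = ℤP.≤-refl
sumFin-nonneg {suc k} f nn = ℤP.+-mono-≤ (nn zero) (sumFin-nonneg (λ i → f (suc i)) (λ i → nn (suc i)))

𝟙 : Bool → ℤ
𝟙 b = if b then 1ℤ else 0ℤ

-- Needed because g_T(ρ) must be
-- realised as a GT-value before condition (iii) can be applied to it.
module _ {X : Set} (P : X → Set) (f : X → ℤ) (nonneg : ∀ x → P x → 0ℤ ≤ f x) where

  Minimiser : Set
  Minimiser = Σ X λ y → P y × (∀ z → P z → f y ≤ f z)

  private
    -- Induction on a natural bound of f x: either x is a minimiser or some
    -- z has a strictly smaller value, hence a smaller bound.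
    bounded : ∀ k x → P x → f x ≤ + k → ¬ ¬ Minimiser
    bounded zero    x px fx≤0 ¬min = ¬min (x , px , λ z pz → ℤP.≤-trans fx≤0 (nonneg z pz))
    bounded (suc k) x px fx≤k ¬min = ¬min (x , px , minimal)
      where
      below : ∀ {i} → i < + suc k → i ≤ + k
      below -<+             = -≤+
      below (+<+ (s≤s i≤k)) = +≤+ i≤k

      minimal : ∀ z → P z → f x ≤ f z
      minimal z pz with f x ≤? f z
      ... | yes fx≤fz = fx≤fz
      ... | no  fx≰fz = ⊥-elim (bounded k z pz (below (ℤP.<-≤-trans (ℤP.≰⇒> fx≰fz) fx≤k)) ¬min)

  ¬¬-minimiser : ∀ x → P x → ¬ ¬ Minimiser
  ¬¬-minimiser x px = bounded ∣ f x ∣ x px (ℤP.≤-reflexive (sym (ℤP.0≤i⇒+∣i∣≡i (nonneg x px))))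

-- The map x ↦ 2x − [x > 0] on ℤ₊ keeps values nonnegative and preserves
-- positivity; it is the perturbation of ζ used in step (a).
double-minus-sign : ∀ x → 0ℤ ≤ x →
  0ℤ ≤ x + x - 𝟙 ⌊ 0ℤ <? x ⌋ × Iff (0ℤ < x) (0ℤ < x + x - 𝟙 ⌊ 0ℤ <? x ⌋)
double-minus-sign (+ zero)  _ = ℤP.≤-refl , (λ p → p) , (λ p → p)
double-minus-sign (+ suc k) _ = ℤP.<⇒≤ positive , (λ _ → positive) , (λ _ → +<+ (s≤s z≤n))
  where
  positive : 0ℤ < + suc k + + suc k - 1ℤ
  positive = +<+ (ℕP.≤-trans (s≤s z≤n) (ℕP.m≤n+m (suc k) k))

entered? : ∀ {n m} (tl hd : Fin m → Fin n) (B : Fin m → Bool) (v : Fin n) → Dec (Entered tl hd B v)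
entered? tl hd B v = any? (λ a → (B a Bool.≟ true) ×-dec (hd a Fin.≟ v))

module Arborescences {n m : ℕ} (tl hd : Fin m → Fin n) (side : Fin n → Bool) (w : Fin m → ℕ) where
  open MSF tl hd side w

  -- Walks of D_T starting in T never reach r_T, since no arc enters r_T;
  -- they are exactly the walks of D in the A[T]-part of the arc set.
  private
    no-walk-to-root : ∀ {B x} → Walk tlT hdT B (just x) nothing → ⊥
    no-walk-to-root (step (inj₁ v) _ () _)
    no-walk-to-root (step (inj₂ a) _ _ r) = no-walk-to-root r

    walk-to-D : ∀ {B x y} → Walk tlT hdT B (just x) (just y) → Walk tl hd (restrictA B) x y
    walk-to-D []                       = []
    walk-to-D (step (inj₁ v) _ () _)
    walk-to-D (step (inj₂ a) b refl r) = step a b refl (walk-to-D r)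

    walk-from-D : ∀ {B x y} → Walk tl hd (restrictA B) x y → Walk tlT hdT B (just x) (just y)
    walk-from-D []              = []
    walk-from-D (step a b refl r) = step (inj₂ a) b refl (walk-from-D r)

  acyclic-from-D : ∀ B → ¬ HasCycle tl hd (restrictA B) → ¬ HasCycle tlT hdT B
  acyclic-from-D B acyclic (inj₁ v , _ , back) = no-walk-to-root back
  acyclic-from-D B acyclic (inj₂ a , b , back) = acyclic (a , b , walk-to-D back)

  acyclic-to-D : ∀ B → ¬ HasCycle tlT hdT B → ¬ HasCycle tl hd (restrictA B)
  acyclic-to-D B acyclic (a , b , back) = acyclic (inj₂ a , b , walk-from-D back)

  rootArcs : (Fin n → ℤ) → Fin n → Bool
  rootArcs η v = if side v then false else ⌊ 0ℤ <? η v ⌋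

  rootArcs-sound : ∀ η v → rootArcs η v ≡ true → InT v × 0ℤ < η v
  rootArcs-sound η v chosen with side v | 0ℤ <? η v
  rootArcs-sound η v ()   | true  | _
  rootArcs-sound η v _    | false | yes pos = refl , pos
  rootArcs-sound η v ()   | false | no _

  rootArcs-complete : ∀ η v → InT v → 0ℤ < η v → rootArcs η v ≡ true
  rootArcs-complete η v inT pos rewrite inT with 0ℤ <? η v
  ... | yes _      = refl
  ... | no  ¬pos   = ⊥-elim (¬pos pos)

  attach : (Fin n → ℤ) → (Fin m → Bool) → ArcT → Bool
  attach η B (inj₁ v) = rootArcs η v
  attach η B (inj₂ a) = B a

  attach-arborescence : ∀ η B → BranchT η B → IsRTArb (attach η B)
  attach-arborescence η B (inA[T] , (acyclic , one-in) , roots) =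
    valid , (acyclic-from-D (attach η B) acyclic , one-in') , entered
    where
    valid : ∀ x → attach η B x ≡ true → ValidT x
    valid (inj₁ v) r = proj₁ (rootArcs-sound η v r)
    valid (inj₂ a) b = inA[T] a b

    root-unentered : ∀ v a → rootArcs η v ≡ true → B a ≡ true → hd a ≡ v → ⊥
    root-unentered v a r b e =
      let (inT , pos) = rootArcs-sound η v r in proj₂ (roots v inT) pos (a , b , e)

    one-in' : ∀ x y → attach η B x ≡ true → attach η B y ≡ true → hdT x ≡ hdT y → x ≡ y
    one-in' (inj₁ v) (inj₁ _) _ _ refl = refl
    one-in' (inj₂ a) (inj₂ b) p q e    = cong inj₂ (one-in a b p q (just-injective e))
    one-in' (inj₁ v) (inj₂ a) r b e    = ⊥-elim (root-unentered v a r b (sym (just-injective e)))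
    one-in' (inj₂ a) (inj₁ v) b r e    = ⊥-elim (root-unentered v a r b (just-injective e))

    entered : ∀ v → InT v → Entered tlT hdT (attach η B) (just v)
    entered v inT with entered? tl hd B v
    ... | yes (a , b , e) = inj₂ a , b , cong just e
    ... | no unentered    = inj₁ v , rootArcs-complete η v inT (proj₁ (roots v inT) unentered) , refl

  rootIndicator : (ArcT → Bool) → Fin n → ℤ
  rootIndicator B v = 𝟙 (B (inj₁ v))

  restrict-branching : ∀ B → IsRTArb B → BranchT (rootIndicator B) (restrictA B)
  restrict-branching B (valid , (acyclic , one-in) , entered) =
    (λ a → valid (inj₂ a)) , (acyclic-to-D B acyclic , one-in') , roots
    where
    one-in' : ∀ a b → B (inj₂ a) ≡ true → B (inj₂ b) ≡ true → hd a ≡ hd b → a ≡ b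
    one-in' a b p q e = inj₂-injective (one-in (inj₂ a) (inj₂ b) p q (cong just e))

    indicator-pos : ∀ v → B (inj₁ v) ≡ true → 0ℤ < rootIndicator B v
    indicator-pos v r rewrite r = +<+ (s≤s z≤n)

    indicator-root : ∀ v → 0ℤ < rootIndicator B v → B (inj₁ v) ≡ true
    indicator-root v pos with B (inj₁ v)
    ... | true = refl
    indicator-root v (+<+ ()) | false

    -- v is entered either by its root arc or by an arc of A[T], not both
    roots : ∀ v → InT v → Iff (¬ Entered tl hd (restrictA B) v) (0ℤ < rootIndicator B v)
    roots v inT = from-root (entered v inT) , to-root
      where
      from-root : Entered tlT hdT B (just v) → ¬ Entered tl hd (restrictA B) v → 0ℤ < rootIndicator B v
      from-root (inj₁ _ , r , refl) _        = indicator-pos v r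
      from-root (inj₂ a , b , refl) unentered = ⊥-elim (unentered (a , b , refl))

      to-root : 0ℤ < rootIndicator B v → ¬ Entered tl hd (restrictA B) v
      to-root pos (a , b , e) with one-in (inj₁ v) (inj₂ a) (indicator-root v pos) b (cong just (sym e))
      ... | ()

  rootIndicator-nonneg : ∀ B v → 0ℤ ≤ rootIndicator B v
  rootIndicator-nonneg B v with B (inj₁ v)
  ... | true  = +≤+ z≤n
  ... | false = ℤP.≤-refl

  dotT-cong : ∀ q {f g} → (∀ v → f v ≡ g v) → dotT q f ≡ dotT q g
  dotT-cong q eq = sumFin-cong (λ v → cong (λ x → if side v then 0ℤ else q v * x) (eq v))

  dotT-+ : ∀ q f g → dotT q (λ v → f v + g v) ≡ dotT q f + dotT q g
  dotT-+ q f g = trans (sumFin-cong distrib)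
    (sumFin-+ (λ v → if side v then 0ℤ else q v * f v) (λ v → if side v then 0ℤ else q v * g v))
    where
    distrib : ∀ v → (if side v then 0ℤ else q v * (f v + g v))
                  ≡ (if side v then 0ℤ else q v * f v) + (if side v then 0ℤ else q v * g v)
    distrib v with side v
    ... | true  = refl
    ... | false = ℤP.*-distribˡ-+ (q v) (f v) (g v)

  weightT-split : ∀ q B → (∀ v → B (inj₁ v) ≡ true → InT v) →
                  weightT q B ≡ dotT q (rootIndicator B) + weight (restrictA B) wℤ
  weightT-split q B rootsInT = cong (_+ weight (restrictA B) wℤ) (sym (sumFin-cong term))
    where
    term : ∀ v → (if side v then 0ℤ else q v * rootIndicator B v) ≡ (if B (inj₁ v) then q v else 0ℤ)
    term v with side v in s | B (inj₁ v) in r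
    ... | true  | true  with () ← trans (sym s) (rootsInT v r)
    ... | true  | false = refl
    ... | false | true  = ℤP.*-identityʳ (q v)
    ... | false | false = ℤP.*-zeroʳ (q v)

  -- g_T depends only on the support of its argument on T.
  SameSupport : (Fin n → ℤ) → (Fin n → ℤ) → Set
  SameSupport η η' = ∀ v → InT v → Iff (0ℤ < η v) (0ℤ < η' v)

  branchT-support : ∀ {η η'} → SameSupport η η' → ∀ B → BranchT η B → BranchT η' B
  branchT-support same B (inA[T] , branching , roots) = inA[T] , branching , λ v inT →
    (λ unentered → proj₁ (same v inT) (proj₁ (roots v inT) unentered)) ,
    (λ pos → proj₂ (roots v inT) (proj₂ (same v inT) pos))

  GT-support : ∀ {η η' c} → SameSupport η η' → (∀ v → InT v → 0ℤ ≤ η' v) → GT η c → GT η' c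
  GT-support {η} {η'} same nonneg (_ , (B , branch , weight≡) , minimal) =
    nonneg , (B , branchT-support same B branch , weight≡) ,
    λ B' branch' → minimal B' (branchT-support same⁻¹ B' branch')
    where
    same⁻¹ : SameSupport η' η
    same⁻¹ v inT = proj₂ (same v inT) , proj₁ (same v inT)

  ¬¬-GT : ∀ η B → (∀ v → InT v → 0ℤ ≤ η v) → BranchT η B → ¬ ¬ (Σ ℤ λ c → GT η c × c ≤ weight B wℤ)
  ¬¬-GT η B nonneg branch no-value =
    ¬¬-minimiser (BranchT η) (λ B → weight B wℤ) (λ B _ → weight-nonneg B) B branch
      λ (B₀ , branch₀ , minimal) →
        no-value (weight B₀ wℤ , (nonneg , (B₀ , branch₀ , refl) , minimal) , minimal B branch)
    where
    weight-nonneg : ∀ B → 0ℤ ≤ weight B wℤ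
    weight-nonneg B = sumFin-nonneg _ (λ a → nonneg-term (B a) (w a))
      where
      nonneg-term : ∀ b k → 0ℤ ≤ (if b then + k else 0ℤ)
      nonneg-term true  k = +≤+ z≤n
      nonneg-term false k = ℤP.≤-refl

module MinimumArborescence {n m : ℕ} (tl hd : Fin m → Fin n) (side : Fin n → Bool) (w : Fin m → ℕ)
                           (ξ : Fin m → Bool) (q : Fin n → ℤ) (cond : MSF.CondIII tl hd side w ξ q) where
  open MSF tl hd side w
  open Arborescences tl hd side w

  ζ : Fin n → ℤ
  ζ = m∂ ξ

  c : ℤ
  c = proj₁ cond

  gT : GT ζ c
  gT = proj₁ (proj₂ cond)

  optimal : ∀ ζ' c' → GT ζ' c' → c + dotT q ζ ≤ c' + dotT q ζ'
  optimal = proj₂ (proj₂ cond)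

  B-T : Fin m → Bool
  B-T = proj₁ (proj₁ (proj₂ gT))

  B-T-branching : BranchT ζ B-T
  B-T-branching = proj₁ (proj₂ (proj₁ (proj₂ gT)))

  B-T-weight : weight B-T wℤ ≡ c
  B-T-weight = proj₂ (proj₂ (proj₁ (proj₂ gT)))

  B̃ : ArcT → Bool
  B̃ = attach ζ B-T

  B̃-arborescence : IsRTArb B̃
  B̃-arborescence = attach-arborescence ζ B-T B-T-branching

  -- χ = 𝟙_{supp⁺ ζ ∩ T}, the head indicator of the root arcs of B̃
  χ : Fin n → ℤ
  χ = rootIndicator B̃

  -- Step (a): perturbing ζ to ζ₂ = 2ζ − χ keeps g_T, so (iii) gives ⟨q, χ⟩ ≤ ⟨q, ζ⟩.
  ζ₂ : Fin n → ℤ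
  ζ₂ v = ζ v + ζ v - χ v

  ζ₂-on-T : ∀ v → InT v → ζ₂ v ≡ ζ v + ζ v - 𝟙 ⌊ 0ℤ <? ζ v ⌋
  ζ₂-on-T v inT = cong (λ s → ζ v + ζ v - 𝟙 (if s then false else ⌊ 0ℤ <? ζ v ⌋)) inT

  ζ₂-nonneg : ∀ v → InT v → 0ℤ ≤ ζ₂ v
  ζ₂-nonneg v inT = subst (0ℤ ≤_) (sym (ζ₂-on-T v inT)) (proj₁ (double-minus-sign (ζ v) (proj₁ gT v inT)))

  ζ₂-support : SameSupport ζ ζ₂
  ζ₂-support v inT = subst (λ y → Iff (0ℤ < ζ v) (0ℤ < y)) (sym (ζ₂-on-T v inT))
                           (proj₂ (double-minus-sign (ζ v) (proj₁ gT v inT)))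

  root-price≤ : dotT q χ ≤ dotT q ζ
  root-price≤ = cancel c (optimal ζ₂ c (GT-support ζ₂-support ζ₂-nonneg gT)) balance
    where
    balance : dotT q ζ₂ + dotT q χ ≡ dotT q ζ + dotT q ζ
    balance = begin
      dotT q ζ₂ + dotT q χ                  ≡⟨ dotT-+ q ζ₂ χ ⟨
      dotT q (λ v → ζ₂ v + χ v)             ≡⟨ dotT-cong q (λ v → minus-plus (ζ v) (χ v)) ⟩
      dotT q (λ v → ζ v + ζ v)              ≡⟨ dotT-+ q ζ ζ ⟩
      dotT q ζ + dotT q ζ                   ∎
      where
      open ≡-Reasoning
      minus-plus : ∀ x h → x + x - h + h ≡ x + x
      minus-plus = solve-∀

    cancel : ∀ c {X Y Z} → c + X ≤ c + Z → Z + Y ≡ X + X → Y ≤ X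
    cancel c {X} {Y} {Z} le eq = begin
      Y                       ≡⟨ shift c X Y ⟨
      c + X + (Y - c - X)     ≤⟨ ℤP.+-monoˡ-≤ (Y - c - X) le ⟩
      c + Z + (Y - c - X)     ≡⟨ shift' c Z Y X ⟩
      Z + Y - X               ≡⟨ cong (_- X) eq ⟩
      X + X - X               ≡⟨ halve X ⟩
      X                       ∎
      where
      open ℤP.≤-Reasoning
      shift : ∀ c X Y → c + X + (Y - c - X) ≡ Y
      shift = solve-∀
      shift' : ∀ c Z Y X → c + Z + (Y - c - X) ≡ Z + Y - X
      shift' = solve-∀
      halve : ∀ X → X + X - X ≡ X
      halve = solve-∀

  B̃-minimum : ∀ B' → IsRTArb B' → weightT q B̃ ≤ weightT q B'
  B̃-minimum B' arborescence' = decidable-stable (weightT q B̃ ≤? weightT q B') λ ≰ →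
    ¬¬-GT ρ (restrictA B') (λ v _ → rootIndicator-nonneg B' v) (restrict-branching B' arborescence')
      λ (c' , gT' , c'≤) → ≰ (compare c' gT' c'≤)
    where
    ρ : Fin n → ℤ
    ρ = rootIndicator B'

    compare : ∀ c' → GT ρ c' → c' ≤ weight (restrictA B') wℤ → weightT q B̃ ≤ weightT q B'
    compare c' gT' c'≤ = begin
      weightT q B̃                          ≡⟨ weightT-split q B̃ (λ v → proj₁ B̃-arborescence (inj₁ v)) ⟩
      dotT q χ + weight B-T wℤ             ≡⟨ cong (_+_ (dotT q χ)) B-T-weight ⟩
      dotT q χ + c                         ≤⟨ ℤP.+-monoˡ-≤ c root-price≤ ⟩
      dotT q ζ + c                         ≡⟨ ℤP.+-comm (dotT q ζ) c ⟩
      c + dotT q ζ                         ≤⟨ optimal ρ c' gT' ⟩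
      c' + dotT q ρ                        ≤⟨ ℤP.+-monoˡ-≤ (dotT q ρ) c'≤ ⟩
      weight (restrictA B') wℤ + dotT q ρ  ≡⟨ ℤP.+-comm (weight (restrictA B') wℤ) (dotT q ρ) ⟩
      dotT q ρ + weight (restrictA B') wℤ  ≡⟨ weightT-split q B' (λ v → proj₁ arborescence' (inj₁ v)) ⟨
      weightT q B'                         ∎
      where open ℤP.≤-Reasoning

lemma5 : {n m : ℕ} (tl hd : Fin m → Fin n) (side : Fin n → Bool) (w : Fin m → ℕ) →
    Σ (Fin n) (λ s → side s ≡ true) →
    Σ (Fin n) (λ t → side t ≡ false) →
    ((a : Fin m) → side (tl a) ≡ false → side (hd a) ≡ false) →
    (ξ : Fin m → Bool) → MSF.OptimalFlow tl hd side w ξ →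
    (p q : Fin n → ℤ) →
    MSF.CondI tl hd side w ξ p q →
    MSF.CondII tl hd side w ξ p →
    MSF.CondIII tl hd side w ξ q →
    MSF.Tight tl hd side w ξ p q →
    Σ (MSF.ArcT tl hd side w → Bool) λ B →
      MSF.MinRTArb tl hd side w q B ×
      ((v : Fin n) → side v ≡ false →
        Iff (¬ Entered tl hd (MSF.restrictA tl hd side w B) v)
            (0ℤ < MSF.m∂ tl hd side w ξ v))
lemma5 tl hd side w _ _ _ ξ _ _ q _ _ condIII _ =
  B̃ , (B̃-arborescence , B̃-minimum) , proj₂ (proj₂ B-T-branching)
  where open MinimumArborescence tl hd side w ξ q condIII
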